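{- Every connected $3$-regular permutation graph is a blow-up of a path.
   Context: All graphs are finite and simple. A graph $G$ on $n$ vertices is a permutation graph if there is a labeling $v_1, \ldots, v_n$ of its vertices and a permutation $\pi$ of $\{1,\ldots,n\}$ such that for $i<j$, $v_i$ and $v_j$ are adjacent iff $\pi(i) > \pi(j)$. For a graph $G$ with vertices $v_1,\ldots,v_n$ and graphs $H_1,\ldots,H_n$, the composition $G[H_1,\ldots,H_n]$ has vertex set the disjoint union of the $V(H_i)$, and $uv$ is an edge iff either $uv \in E(H_i)$ for some $i$, or $u \in V(H_i)$, $v \in V(H_j)$ for distinct $i,j$ with $v_iv_j \in E(G)$. If every $H_i$ is a complete graph or an edgeless graph on at least one vertex, this is a blow-up of $G$; a blow-up of a path is a blow-up of some path $P_m$, $m\ge1$. -}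

module Defs where

open import Data.Nat using (ℕ; zero; suc) renaming (_<_ to _<ℕ_; _+_ to _+ℕ_)
open import Data.Nat as ℕ using ()
open import Data.Bool using (Bool; true; false; if_then_else_)
open import Data.Fin using (Fin; toℕ; _<_)
open import Data.List using (List; map; allFin)
open import Data.Nat.ListAction using (sum)
open import Data.Product using (Σ; ∃; _×_; _,_)
open import Data.Sum using (_⊎_)
open import Relation.Binary.PropositionalEquality using (_≡_; _≢_)
open import Relation.Binary.Construct.Closure.ReflexiveTransitive using (Star)
open import Function.Bundles using (_⇔_)
open import Data.Fin.Permutation using (Permutation′; _⟨$⟩ʳ_)

record Graph (n : ℕ) : Set where
  field
    adj    : Fin n → Fin n → Bool
    sym    : ∀ i j → adj i j ≡ adj j i
    irrefl : ∀ i → adj i i ≡ false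

open Graph public

Edge : ∀ {n} → Graph n → Fin n → Fin n → Set
Edge G u v = adj G u v ≡ true

degree : ∀ {n} → Graph n → Fin n → ℕ
degree {n} G v = sum (map (λ w → if adj G v w then 1 else 0) (allFin n))

Regular : ∀ {n} → ℕ → Graph n → Set
Regular {n} d G = ∀ (v : Fin n) → degree G v ≡ d

Connected : ∀ {n} → Graph n → Set
Connected {n} G = (0 <ℕ n) × (∀ (u v : Fin n) → Star (Edge G) u v)

IsPermutationGraph : ∀ {n} → Graph n → Set
IsPermutationGraph {n} G =
  Σ (Permutation′ n) λ σ → Σ (Permutation′ n) λ π →
    ∀ (i j : Fin n) → i < j →
      (Edge G (σ ⟨$⟩ʳ i) (σ ⟨$⟩ʳ j) ⇔ (π ⟨$⟩ʳ j) < (π ⟨$⟩ʳ i))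

PathAdj : ∀ {m} → Fin m → Fin m → Set
PathAdj a b = (suc (toℕ a) ≡ toℕ b) ⊎ (suc (toℕ b) ≡ toℕ a)

-- G is (isomorphic to) a blow-up P_m[H_1,…,H_m] of a path P_m, m ≥ 1:
-- f sends each vertex of G to the index of the part H_k containing it
-- (parts nonempty = f surjective), and c k says whether H_k is complete
-- (true) or edgeless (false).
IsBlowupOfPath : ∀ {n} → Graph n → Set
IsBlowupOfPath {n} G =
  Σ ℕ λ m → (1 ℕ.≤ m) ×
  Σ (Fin n → Fin m) λ f → (∀ (k : Fin m) → ∃ λ v → f v ≡ k) ×
  Σ (Fin m → Bool) λ c →
    ∀ (u v : Fin n) → u ≢ v →
      (Edge G u v ⇔ (((f u ≡ f v) × (c (f u) ≡ true)) ⊎ PathAdj (f u) (f v)))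

-- Number the vertices along the permutation, so that positions i < j are adjacent exactly when
-- π j < π i. In a cubic permutation graph every position moves by at most 3, so position k is
-- described by its offset π k + 3 − k ∈ [0, 6] together with a 6-bit state recording which
-- nearby values are used by earlier positions; only 18 states occur. Summing a finite table of
-- increments along this automaton gives a potential on positions, and an exhaustive check of all
-- windows of at most 14 positions shows that it is a layering: adjacent positions differ by at most 1,
-- a difference of exactly 1 forces adjacency, the potential grows by at least 2 over 7 steps, and
-- each level is a clique or an independent set. By connectivity the levels form an interval, and
-- they are the parts of a blow-up of a path.

module Submission where

open import Defs hiding (sym)
open import Data.Bool using (Bool; true; false; T; _∨_; if_then_else_)
import Data.Bool as Bool
open import Data.Bool.Properties using (T-≡; T-∨)
import Data.Bool.Properties as Bool
open import Data.Fin as Fin using (Fin; zero; suc; toℕ; fromℕ<)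
open import Data.Fin.Properties using (any?; injective⇒≤; toℕ<n; toℕ-fromℕ<; fromℕ<-toℕ; toℕ-injective)
open import Data.Fin.Permutation using (Permutation′; _⟨$⟩ʳ_; _⟨$⟩ˡ_; inverseˡ; inverseʳ)
open import Data.Integer as ℤ using (ℤ; 0ℤ; -1ℤ; ∣_∣; _⊖_)
import Data.Integer.Properties as ℤ
open import Data.Integer.Tactic.RingSolver using (solve-∀)
open import Data.List using (List; []; _∷_; length; lookup; upTo; map; _++_; filter; filterᵇ; allFin)
open import Data.List.Membership.Propositional using (_∈_)
open import Data.List.Membership.Propositional.Properties
  using (∈-lookup; ∈-upTo⁺; ∈-upTo⁻; ∈-++⁺ˡ; ∈-++⁺ʳ; ∈-map⁺; ∈-map⁻; ∈-filter⁺; ∈-filter⁻; ∈-allFin)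
open import Data.List.Properties using (length-applyUpTo; length-++; length-map)
open import Data.List.Relation.Unary.All as All using (All; all?)
open import Data.List.Relation.Unary.AllPairs using (_∷_)
open import Data.List.Relation.Unary.Any using (here; there; index)
open import Data.List.Relation.Unary.Any.Properties using (lookup-index)
open import Data.List.Relation.Unary.Unique.Propositional using (Unique)
import Data.List.Relation.Unary.Unique.Propositional.Properties as Unique
open import Data.Nat using (ℕ; zero; suc; _+_; _∸_; _≤_; _<_; z≤n; s≤s; _<?_; _≤?_; _≟_; _≡ᵇ_; _⊓_; ∣_-_∣)
open import Data.Nat.Induction using (<-rec)
open import Data.Nat.ListAction using (sum)
open import Data.Nat.Properties
open import Data.Product using (∃; ∃₂; _×_; _,_; proj₁; proj₂)
open import Data.Sum using (_⊎_; inj₁; inj₂)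
open import Data.Unit using (tt)
open import Data.Vec using (Vec; []; _∷_)
open import Data.Vec.Properties using (≡-dec)
open import Function using (_∘_)
open import Function.Bundles using (_⇔_; mk⇔; Equivalence)
import Function.Properties.Equivalence as ⇔
open import Relation.Binary.Core using (Rel)
open import Relation.Binary.Construct.Closure.ReflexiveTransitive using (Star; ε; _◅_)
open import Relation.Binary.Definitions using (Total; Reflexive; Transitive; tri<; tri≈; tri>)
open import Relation.Binary.PropositionalEquality
open import Relation.Nullary using (¬_; yes; no; contradiction)
open import Relation.Nullary.Decidable using (Dec; does; map′; _×-dec_; _⊎-dec_; _→-dec_; ¬?; T?; dec-true; toWitness)
open import Data.List.Membership.DecPropositional (≡-dec {n = 6} Bool._≟_) using (_∈?_)

-- Layered graphs

∣m-n∣≤1⇒n≤1+m : ∀ m n → ∣ m - n ∣ ≤ 1 → n ≤ suc m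
∣m-n∣≤1⇒n≤1+m zero    n       d = d
∣m-n∣≤1⇒n≤1+m (suc m) zero    d = z≤n
∣m-n∣≤1⇒n≤1+m (suc m) (suc n) d = s≤s (∣m-n∣≤1⇒n≤1+m m n d)

∣m-n∣≡1⇒1+m≡n⊎1+n≡m : ∀ m n → ∣ m - n ∣ ≡ 1 → suc m ≡ n ⊎ suc n ≡ m
∣m-n∣≡1⇒1+m≡n⊎1+n≡m zero    (suc zero) _ = inj₁ refl
∣m-n∣≡1⇒1+m≡n⊎1+n≡m (suc zero) zero    _ = inj₂ refl
∣m-n∣≡1⇒1+m≡n⊎1+n≡m (suc m) (suc n)   d with ∣m-n∣≡1⇒1+m≡n⊎1+n≡m m n d
... | inj₁ e = inj₁ (cong suc e)
... | inj₂ e = inj₂ (cong suc e)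

∣m-1+m∣≡1 : ∀ m → ∣ m - suc m ∣ ≡ 1
∣m-1+m∣≡1 zero    = refl
∣m-1+m∣≡1 (suc m) = ∣m-1+m∣≡1 m

1+m≡n⊎1+n≡m⇒∣m-n∣≡1 : ∀ {m n} → suc m ≡ n ⊎ suc n ≡ m → ∣ m - n ∣ ≡ 1
1+m≡n⊎1+n≡m⇒∣m-n∣≡1 {m} (inj₁ refl) = ∣m-1+m∣≡1 m
1+m≡n⊎1+n≡m⇒∣m-n∣≡1 {n = n} (inj₂ refl) = trans (∣-∣-comm (suc n) n) (∣m-1+m∣≡1 n)

∣m⊖n∣≡∣m-n∣ : ∀ m n → ∣ m ⊖ n ∣ ≡ ∣ m - n ∣
∣m⊖n∣≡∣m-n∣ m n with ≤-total m n
... | inj₁ m≤n = trans (ℤ.∣⊖∣-≤ m≤n) (sym (m≤n⇒∣m-n∣≡n∸m m≤n))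
... | inj₂ n≤m = begin
  ∣ m ⊖ n ∣ ≡⟨ ℤ.∣m⊖n∣≡∣n⊖m∣ m n ⟩
  ∣ n ⊖ m ∣ ≡⟨ ℤ.∣⊖∣-≤ n≤m ⟩
  m ∸ n   ≡⟨ m≤n⇒∣m-n∣≡n∸m n≤m ⟨
  ∣ n - m ∣ ≡⟨ ∣-∣-comm n m ⟩
  ∣ m - n ∣ ∎
  where open ≡-Reasoning

walk-intermediate : ∀ {ℓ} {V : Set} {E : Rel V ℓ} (h : V → ℕ) →
  (∀ {x y} → E x y → h y ≤ suc (h x)) →
  ∀ {x y} → Star E x y → ∀ {t} → h x ≤ t → t ≤ h y → ∃ λ z → h z ≡ t
walk-intermediate h step {x} ε hx≤t t≤hy = x , ≤-antisym hx≤t t≤hy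
walk-intermediate h step {x} (e ◅ w) {t} hx≤t t≤hy with h x ≟ t
... | yes hx≡t = x , hx≡t
... | no  hx≢t = walk-intermediate h step w (≤-trans (step e) (≤∧≢⇒< hx≤t hx≢t)) t≤hy

attains-minimum : ∀ {A : Set} {ℓ} {_≤_ : Rel A ℓ} → Total _≤_ → Reflexive _≤_ → Transitive _≤_ →
  ∀ {m} → 0 < m → (f : Fin m → A) → ∃ λ v → ∀ w → f v ≤ f w
attains-minimum total reflexive transitive {suc zero} _ f = zero , λ { zero → reflexive }
attains-minimum total reflexive transitive {suc (suc m)} _ f
  with attains-minimum total reflexive transitive (s≤s z≤n) (f ∘ suc)
... | v , min with total (f zero) (f (suc v))
...   | inj₁ f0≤fv = zero , λ { zero → reflexive ; (suc w) → transitive f0≤fv (min w) }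
...   | inj₂ fv≤f0 = suc v , λ { zero → fv≤f0 ; (suc w) → min w }

record Layering {n : ℕ} (G : Graph n) : Set where
  field
    layer : Fin n → ℤ
    edge⇒∣Δlayer∣≤1 : ∀ {u v} → Edge G u v → ∣ layer u ℤ.- layer v ∣ ≤ 1
    ∣Δlayer∣≡1⇒edge : ∀ {u v} → ∣ layer u ℤ.- layer v ∣ ≡ 1 → Edge G u v
    layer-homogeneous : ∀ {u v x y} → u ≢ v → layer u ≡ layer v →
      layer x ≡ layer u → layer y ≡ layer u → Edge G x y → Edge G u v

module _ {n : ℕ} {G : Graph n} (connected : Connected G) (L : Layering G) where
  open Layering L
  private
    lowest : ∃ λ v → ∀ w → layer v ℤ.≤ layer w
    lowest = attains-minimum ℤ.≤-total ℤ.≤-refl ℤ.≤-trans (proj₁ connected) layer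

    highest : ∃ λ v → ∀ w → layer w ℤ.≤ layer v
    highest = attains-minimum (λ i j → ℤ.≤-total j i) ℤ.≤-refl (λ j≤i k≤j → ℤ.≤-trans k≤j j≤i) (proj₁ connected) layer

    bottom top : Fin n
    bottom = proj₁ lowest
    top    = proj₁ highest

    height : Fin n → ℕ
    height v = ∣ layer v ℤ.- layer bottom ∣

    +height : ∀ v → ℤ.+ height v ≡ layer v ℤ.- layer bottom
    +height v = ℤ.0≤i⇒+∣i∣≡i (ℤ.i≤j⇒0≤j-i (proj₂ lowest v))

    height-bottom : height bottom ≡ 0
    height-bottom = cong ∣_∣ (ℤ.+-inverseʳ (layer bottom))

    height≤top : ∀ v → height v ≤ height top
    height≤top v = ℤ.drop‿+≤+ (subst₂ ℤ._≤_ (sym (+height v)) (sym (+height top))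
      (ℤ.+-monoˡ-≤ (ℤ.- layer bottom) (proj₂ highest v)))

    ∣Δlayer∣≡∣Δheight∣ : ∀ u v → ∣ layer u ℤ.- layer v ∣ ≡ ∣ height u - height v ∣
    ∣Δlayer∣≡∣Δheight∣ u v = begin
      ∣ layer u ℤ.- layer v ∣              ≡⟨ cong ∣_∣ (telescope (layer u) (layer v) (layer bottom)) ⟩
      ∣ (layer u ℤ.- layer bottom) ℤ.- (layer v ℤ.- layer bottom) ∣
        ≡⟨ cong₂ (λ a b → ∣ a ℤ.- b ∣) (+height u) (+height v) ⟨
      ∣ ℤ.+ height u ℤ.- ℤ.+ height v ∣         ≡⟨ cong ∣_∣ (ℤ.[+m]-[+n]≡m⊖n (height u) (height v)) ⟩
      ∣ height u ⊖ height v ∣               ≡⟨ ∣m⊖n∣≡∣m-n∣ (height u) (height v) ⟩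
      ∣ height u - height v ∣               ∎
      where
        open ≡-Reasoning
        telescope : ∀ a b c → a ℤ.- b ≡ (a ℤ.- c) ℤ.- (b ℤ.- c)
        telescope = solve-∀

    same-height⇒same-layer : ∀ {u v} → height u ≡ height v → layer u ≡ layer v
    same-height⇒same-layer {u} {v} e =
      ℤ.i-j≡0⇒i≡j _ _ (ℤ.∣i∣≡0⇒i≡0 (trans (∣Δlayer∣≡∣Δheight∣ u v) (m≡n⇒∣m-n∣≡0 e)))

    part : Fin n → Fin (suc (height top))
    part v = fromℕ< (s≤s (height≤top v))

    toℕ-part : ∀ v → toℕ (part v) ≡ height v
    toℕ-part v = toℕ-fromℕ< (s≤s (height≤top v))

    same-part⇔same-layer : ∀ {u v} → part u ≡ part v ⇔ layer u ≡ layer v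
    same-part⇔same-layer {u} {v} = mk⇔
      (λ e → same-height⇒same-layer (trans (sym (toℕ-part u)) (trans (cong toℕ e) (toℕ-part v))))
      (λ e → toℕ-injective (trans (toℕ-part u) (trans (cong (λ l → ∣ l ℤ.- layer bottom ∣) e) (sym (toℕ-part v)))))

    path-adjacent⇔∣Δlayer∣≡1 : ∀ {u v} → PathAdj (part u) (part v) ⇔ ∣ layer u ℤ.- layer v ∣ ≡ 1
    path-adjacent⇔∣Δlayer∣≡1 {u} {v} = mk⇔
      (λ a → trans (∣Δlayer∣≡∣Δheight∣ u v) (1+m≡n⊎1+n≡m⇒∣m-n∣≡1 (heights a)))
      (λ d → parts (∣m-n∣≡1⇒1+m≡n⊎1+n≡m _ _ (trans (sym (∣Δlayer∣≡∣Δheight∣ u v)) d)))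
      where
        heights : PathAdj (part u) (part v) → suc (height u) ≡ height v ⊎ suc (height v) ≡ height u
        heights (inj₁ e) = inj₁ (subst₂ (λ a b → suc a ≡ b) (toℕ-part u) (toℕ-part v) e)
        heights (inj₂ e) = inj₂ (subst₂ (λ a b → suc a ≡ b) (toℕ-part v) (toℕ-part u) e)
        parts : suc (height u) ≡ height v ⊎ suc (height v) ≡ height u → PathAdj (part u) (part v)
        parts (inj₁ e) = inj₁ (subst₂ (λ a b → suc a ≡ b) (sym (toℕ-part u)) (sym (toℕ-part v)) e)
        parts (inj₂ e) = inj₂ (subst₂ (λ a b → suc a ≡ b) (sym (toℕ-part v)) (sym (toℕ-part u)) e)

    part-surjective : ∀ k → ∃ λ v → part v ≡ k
    part-surjective k with walk-intermediate height
      (λ {x} {y} e → ∣m-n∣≤1⇒n≤1+m (height x) (height y) (subst (_≤ 1) (∣Δlayer∣≡∣Δheight∣ x y) (edge⇒∣Δlayer∣≤1 e)))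
      (proj₂ connected bottom top) (subst (_≤ toℕ k) (sym height-bottom) z≤n) (≤-pred (toℕ<n k))
    ... | v , e = v , toℕ-injective (trans (toℕ-part v) e)

    EdgeIn : Fin (suc (height top)) → Set
    EdgeIn k = ∃₂ λ x y → part x ≡ k × part y ≡ k × Edge G x y

    edgeIn? : ∀ k → Dec (EdgeIn k)
    edgeIn? k = any? λ x → any? λ y → (part x Fin.≟ k) ×-dec (part y Fin.≟ k) ×-dec (adj G x y Bool.≟ true)

    complete : Fin (suc (height top)) → Bool
    complete k = does (edgeIn? k)

    edge⇔blowup-edge : ∀ {u v} → u ≢ v →
      Edge G u v ⇔ (((part u ≡ part v) × (complete (part u) ≡ true)) ⊎ PathAdj (part u) (part v))
    edge⇔blowup-edge {u} {v} u≢v = mk⇔ to from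
      where
        to : Edge G u v → ((part u ≡ part v) × (complete (part u) ≡ true)) ⊎ PathAdj (part u) (part v)
        to e with n≤1⇒n≡0∨n≡1 (edge⇒∣Δlayer∣≤1 e)
        ... | inj₁ ∣Δ∣≡0 = inj₁ (same , dec-true (edgeIn? (part u)) (u , v , refl , sym same , e))
          where same = Equivalence.from same-part⇔same-layer (ℤ.i-j≡0⇒i≡j _ _ (ℤ.∣i∣≡0⇒i≡0 ∣Δ∣≡0))
        ... | inj₂ ∣Δ∣≡1 = inj₂ (Equivalence.from path-adjacent⇔∣Δlayer∣≡1 ∣Δ∣≡1)
        from : ((part u ≡ part v) × (complete (part u) ≡ true)) ⊎ PathAdj (part u) (part v) → Edge G u v
        from (inj₁ (same , c)) with edgeIn? (part u)
        ... | yes (x , y , x-part , y-part , exy) = layer-homogeneous u≢v (same-layer same)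
              (same-layer x-part) (same-layer y-part) exy
          where
            same-layer : ∀ {a b} → part a ≡ part b → layer a ≡ layer b
            same-layer = Equivalence.to same-part⇔same-layer
        from (inj₁ (_ , ())) | no _
        from (inj₂ a) = ∣Δlayer∣≡1⇒edge (Equivalence.to path-adjacent⇔∣Δlayer∣≡1 a)

  layering⇒blowupOfPath : IsBlowupOfPath G
  layering⇒blowupOfPath = suc (height top) , s≤s z≤n , part , part-surjective , complete , λ u v → edge⇔blowup-edge

-- Cubic permutations

module _ {A : Set} where

  unique-lookup-injective : ∀ {xs : List A} → Unique xs → ∀ {i j} → lookup xs i ≡ lookup xs j → i ≡ j
  unique-lookup-injective (_  ∷ _) {zero}  {zero}  _ = refl
  unique-lookup-injective (x≢ ∷ _) {zero}  {suc j} e = contradiction e (All.lookup x≢ (∈-lookup j))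
  unique-lookup-injective (x≢ ∷ _) {suc i} {zero}  e = contradiction (sym e) (All.lookup x≢ (∈-lookup i))
  unique-lookup-injective (_  ∷ u) {suc i} {suc j} e = cong suc (unique-lookup-injective u e)

length-≤-injection : ∀ {A B : Set} {xs : List A} {ys : List B} (f : A → B) → Unique xs →
  (∀ {x} → x ∈ xs → f x ∈ ys) → (∀ {x y} → x ∈ xs → y ∈ xs → f x ≡ f y → x ≡ y) →
  length xs ≤ length ys
length-≤-injection {xs = xs} {ys} f u into inj = injective⇒≤ h-injective
  where
    h : Fin (length xs) → Fin (length ys)
    h i = index (into (∈-lookup i))

    h-injective : ∀ {i j} → h i ≡ h j → i ≡ j
    h-injective {i} {j} e = unique-lookup-injective u (inj (∈-lookup i) (∈-lookup j) (begin
      f (lookup xs i) ≡⟨ lookup-index (into (∈-lookup i)) ⟩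
      lookup ys (h i) ≡⟨ cong (lookup ys) e ⟩
      lookup ys (h j) ≡⟨ lookup-index (into (∈-lookup j)) ⟨
      f (lookup xs j) ∎))
      where open ≡-Reasoning

Crosses : (ℕ → ℕ) → ℕ → ℕ → Set
Crosses π k j = (j < k × π k < π j) ⊎ (k < j × π j < π k)

-- Positions and values are the naturals below n; π and π⁻¹ are arbitrary beyond n.
record CubicPermutation (n : ℕ) : Set where
  field
    π π⁻¹            : ℕ → ℕ
    π-<              : ∀ {j} → j < n → π j < n
    π⁻¹-<            : ∀ {v} → v < n → π⁻¹ v < n
    π-π⁻¹            : ∀ {v} → v < n → π (π⁻¹ v) ≡ v
    π⁻¹-π            : ∀ {j} → j < n → π⁻¹ (π j) ≡ j
    crossings        : ∀ {k} → k < n → List ℕ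
    crossings-unique : ∀ {k} (k<n : k < n) → Unique (crossings k<n)
    crossings-length : ∀ {k} (k<n : k < n) → length (crossings k<n) ≡ 3
    ∈-crossings      : ∀ {k j} (k<n : k < n) → j ∈ crossings k<n ⇔ (j < n × Crosses π k j)
    indecomposable   : ∀ {k} → 0 < k → k < n → ∃₂ λ i j → i < k × k ≤ j × j < n × π j < π i

module Displacement {n} (C : CubicPermutation n) where
  open CubicPermutation C

  π-injective : ∀ {i j} → i < n → j < n → π i ≡ π j → i ≡ j
  π-injective {i} {j} i<n j<n e = trans (sym (π⁻¹-π i<n)) (trans (cong π⁻¹ e) (π⁻¹-π j<n))

  π⁻¹-injective : ∀ {v w} → v < n → w < n → π⁻¹ v ≡ π⁻¹ w → v ≡ w
  π⁻¹-injective {v} {w} v<n w<n e = trans (sym (π-π⁻¹ v<n)) (trans (cong π e) (π-π⁻¹ w<n))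

  -- Of the values below π k at most k sit before position k; the others sit after k and cross it.
  π[k]≤k+3 : ∀ {k} → k < n → π k ≤ k + 3
  π[k]≤k+3 {k} k<n = subst₂ _≤_ (length-applyUpTo _ (π k))
    (trans (length-++ (upTo k)) (cong₂ _+_ (length-applyUpTo _ k) (crossings-length k<n)))
    (length-≤-injection π⁻¹ (Unique.upTo⁺ (π k)) into
      (λ v∈ w∈ → π⁻¹-injective (value<n v∈) (value<n w∈)))
    where
      value<n : ∀ {v} → v ∈ upTo (π k) → v < n
      value<n v∈ = <-trans (∈-upTo⁻ v∈) (π-< k<n)

      into : ∀ {v} → v ∈ upTo (π k) → π⁻¹ v ∈ upTo k ++ crossings k<n
      into {v} v∈ with π⁻¹ v <? k
      ... | yes j<k = ∈-++⁺ˡ (∈-upTo⁺ j<k)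
      ... | no  j≮k = ∈-++⁺ʳ (upTo k) (Equivalence.from (∈-crossings k<n)
                        (π⁻¹-< (value<n v∈) , inj₂ (k<j , subst (_< π k) (sym (π-π⁻¹ (value<n v∈))) (∈-upTo⁻ v∈))))
        where
          k<j : k < π⁻¹ v
          k<j = ≤∧≢⇒< (≮⇒≥ j≮k) λ k≡j → <-irrefl (sym (trans (cong π k≡j) (π-π⁻¹ (value<n v∈)))) (∈-upTo⁻ v∈)

  k≤π[k]+3 : ∀ {k} → k < n → k ≤ π k + 3
  k≤π[k]+3 {k} k<n = subst₂ _≤_ (length-applyUpTo _ k)
    (trans (length-++ (upTo (π k))) (cong₂ _+_ (length-applyUpTo _ (π k))
      (trans (length-map π (crossings k<n)) (crossings-length k<n))))
    (length-≤-injection π (Unique.upTo⁺ k) into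
      (λ i∈ j∈ → π-injective (position<n i∈) (position<n j∈)))
    where
      position<n : ∀ {j} → j ∈ upTo k → j < n
      position<n j∈ = <-trans (∈-upTo⁻ j∈) k<n

      into : ∀ {j} → j ∈ upTo k → π j ∈ upTo (π k) ++ map π (crossings k<n)
      into {j} j∈ with π j <? π k
      ... | yes πj<πk = ∈-++⁺ˡ (∈-upTo⁺ πj<πk)
      ... | no  πj≮πk = ∈-++⁺ʳ (upTo (π k)) (∈-map⁺ π (Equivalence.from (∈-crossings k<n)
                          (position<n j∈ , inj₁ (∈-upTo⁻ j∈ , πk<πj))))
        where
          πk<πj : π k < π j
          πk<πj = ≤∧≢⇒< (≮⇒≥ πj≮πk) λ πk≡πj →
            <-irrefl (π-injective (position<n j∈) k<n (sym πk≡πj)) (∈-upTo⁻ j∈)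

-- The window automaton

pattern ● = true
pattern ○ = false

-- Bit r of the state at position k says whether the shifted value k + r is used by a position
-- before k (see Describes); position k itself takes the shifted value k + o for its offset o.
State : Set
State = Vec Bool 6

bit : ∀ {m} → Vec Bool m → ℕ → Bool
bit []       _       = false
bit (b ∷ _)  zero    = b
bit (_ ∷ bs) (suc r) = bit bs r

bit-beyond : ∀ {m} (bs : Vec Bool m) {r} → m ≤ r → bit bs r ≡ false
bit-beyond []       _         = refl
bit-beyond (_ ∷ bs) (s≤s m≤r) = bit-beyond bs m≤r

next : State → ℕ → State
next (_ ∷ b₁ ∷ b₂ ∷ b₃ ∷ b₄ ∷ b₅ ∷ []) o =
  (b₁ ∨ (o ≡ᵇ 1)) ∷ (b₂ ∨ (o ≡ᵇ 2)) ∷ (b₃ ∨ (o ≡ᵇ 3)) ∷ (b₄ ∨ (o ≡ᵇ 4)) ∷ (b₅ ∨ (o ≡ᵇ 5)) ∷ (o ≡ᵇ 6) ∷ []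

bit-next : ∀ s o {r} → r < 6 → bit (next s o) r ≡ bit s (suc r) ∨ (o ≡ᵇ suc r)
bit-next (_ ∷ _ ∷ _ ∷ _ ∷ _ ∷ _ ∷ []) o {0} _ = refl
bit-next (_ ∷ _ ∷ _ ∷ _ ∷ _ ∷ _ ∷ []) o {1} _ = refl
bit-next (_ ∷ _ ∷ _ ∷ _ ∷ _ ∷ _ ∷ []) o {2} _ = refl
bit-next (_ ∷ _ ∷ _ ∷ _ ∷ _ ∷ _ ∷ []) o {3} _ = refl
bit-next (_ ∷ _ ∷ _ ∷ _ ∷ _ ∷ _ ∷ []) o {4} _ = refl
bit-next (_ ∷ _ ∷ _ ∷ _ ∷ _ ∷ _ ∷ []) o {5} _ = refl
bit-next _ _ {suc (suc (suc (suc (suc (suc _)))))} (s≤s (s≤s (s≤s (s≤s (s≤s (s≤s ()))))))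

-- The state after a prefix of positions that carries exactly the values below its length.
boundary : State
boundary = ● ∷ ● ∷ ● ∷ ○ ∷ ○ ∷ ○ ∷ []

boundary-taken : ∀ {r} → r < 3 → T (bit boundary r)
boundary-taken {0} _ = _
boundary-taken {1} _ = _
boundary-taken {2} _ = _
boundary-taken {suc (suc (suc _))} (s≤s (s≤s (s≤s ())))

boundary-free : ∀ {r} → 3 ≤ r → ¬ T (bit boundary r)
boundary-free {0} ()
boundary-free {1} (s≤s ())
boundary-free {2} (s≤s (s≤s ()))
boundary-free {3} _ ()
boundary-free {4} _ ()
boundary-free {5} _ ()
boundary-free {suc (suc (suc (suc (suc (suc _)))))} _ ()

-- Used slots above o belong to earlier positions with larger values, free slots below o to later
-- positions with smaller values: these are the positions crossing k.
CrossingSlot : State → ℕ → ℕ → Set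
CrossingSlot s o r = (o < r × T (bit s r)) ⊎ (r < o × ¬ T (bit s r))

crossingSlot? : ∀ s o r → Dec (CrossingSlot s o r)
crossingSlot? s o r = (o <? r ×-dec T? (bit s r)) ⊎-dec (r <? o ×-dec ¬? (T? (bit s r)))

crossingSlots : State → ℕ → List ℕ
crossingSlots s o = filter (crossingSlot? s o) (upTo 6)

record Valid (s : State) (o : ℕ) : Set where
  field
    offset≤6             : o ≤ 6
    own-slot-free        : ¬ T (bit s o)
    three-crossing-slots : length (crossingSlots s o) ≡ 3
    lowest-slot-filled   : T (bit s 0) ⊎ o ≡ 0

valid? : ∀ s o → Dec (Valid s o)
valid? s o = map′
  (λ (a , b , c , d) → record { offset≤6 = a ; own-slot-free = b ; three-crossing-slots = c ; lowest-slot-filled = d })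
  (λ v → let open Valid v in offset≤6 , own-slot-free , three-crossing-slots , lowest-slot-filled)
  (o ≤? 6 ×-dec ¬? (T? (bit s o)) ×-dec length (crossingSlots s o) ≟ 3 ×-dec (T? (bit s 0) ⊎-dec o ≟ 0))

-- The 18 states reachable from boundary by valid steps.
reachable : List State
reachable =
  (● ∷ ● ∷ ● ∷ ○ ∷ ○ ∷ ○ ∷ []) ∷ (● ∷ ● ∷ ○ ∷ ● ∷ ○ ∷ ○ ∷ []) ∷ (● ∷ ● ∷ ○ ∷ ○ ∷ ● ∷ ○ ∷ []) ∷
  (● ∷ ● ∷ ○ ∷ ○ ∷ ○ ∷ ● ∷ []) ∷ (● ∷ ○ ∷ ● ∷ ● ∷ ○ ∷ ○ ∷ []) ∷ (● ∷ ○ ∷ ● ∷ ○ ∷ ○ ∷ ● ∷ []) ∷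
  (● ∷ ○ ∷ ○ ∷ ● ∷ ● ∷ ○ ∷ []) ∷ (● ∷ ○ ∷ ○ ∷ ● ∷ ○ ∷ ● ∷ []) ∷ (● ∷ ○ ∷ ○ ∷ ○ ∷ ● ∷ ● ∷ []) ∷
  (○ ∷ ● ∷ ● ∷ ● ∷ ○ ∷ ○ ∷ []) ∷ (○ ∷ ● ∷ ● ∷ ○ ∷ ● ∷ ○ ∷ []) ∷ (○ ∷ ● ∷ ● ∷ ○ ∷ ○ ∷ ● ∷ []) ∷
  (○ ∷ ● ∷ ○ ∷ ● ∷ ● ∷ ○ ∷ []) ∷ (○ ∷ ● ∷ ○ ∷ ○ ∷ ● ∷ ● ∷ []) ∷ (○ ∷ ○ ∷ ● ∷ ● ∷ ● ∷ ○ ∷ []) ∷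
  (○ ∷ ○ ∷ ● ∷ ● ∷ ○ ∷ ● ∷ []) ∷ (○ ∷ ○ ∷ ● ∷ ○ ∷ ● ∷ ● ∷ []) ∷ (○ ∷ ○ ∷ ○ ∷ ● ∷ ● ∷ ● ∷ []) ∷ []

ClosedAt : State → Set
ClosedAt s = ∀ {o} → o < 7 → Valid s o → next s o ∈ reachable

reachable-closed : All ClosedAt reachable
reachable-closed =
  toWitness {a? = all? (λ s → allUpTo? (λ o → valid? s o →-dec next s o ∈? reachable) 7) reachable} tt

module Prefix {n} (C : CubicPermutation n) where
  open CubicPermutation C
  open Displacement C

  -- Values are shifted by 3 to stay in ℕ; the shifted values 0, 1, 2 count as used from the start.
  Taken : ℕ → ℕ → Set
  Taken k w = w < 3 ⊎ ∃ λ j → j < k × π j + 3 ≡ w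

  Describes : ℕ → State → Set
  Describes k s = ∀ {r} → r < 6 → T (bit s r) ⇔ Taken k (k + r)

  taken-suc : ∀ {k w} → Taken (suc k) w ⇔ (Taken k w ⊎ π k + 3 ≡ w)
  taken-suc {k} = mk⇔ to from
    where
      to : ∀ {w} → Taken (suc k) w → Taken k w ⊎ π k + 3 ≡ w
      to (inj₁ w<3) = inj₁ (inj₁ w<3)
      to (inj₂ (j , j<1+k , e)) with m≤n⇒m<n∨m≡n (≤-pred j<1+k)
      ... | inj₁ j<k  = inj₁ (inj₂ (j , j<k , e))
      ... | inj₂ refl = inj₂ e
      from : ∀ {w} → Taken k w ⊎ π k + 3 ≡ w → Taken (suc k) w
      from (inj₁ (inj₁ w<3))            = inj₁ w<3
      from (inj₁ (inj₂ (j , j<k , e))) = inj₂ (j , m<n⇒m<1+n j<k , e)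
      from (inj₂ e)                     = inj₂ (k , n<1+n k , e)

  taken-bounded : ∀ {k w} → k ≤ n → Taken k w → w < k + 6
  taken-bounded {k} _   (inj₁ w<3) = <-≤-trans w<3 (≤-trans (s≤s (s≤s (s≤s z≤n))) (m≤n+m 6 k))
  taken-bounded {k} k≤n (inj₂ (j , j<k , refl)) =
    ≤-<-trans (+-monoˡ-≤ 3 (π[k]≤k+3 (<-≤-trans j<k k≤n)))
      (subst (_< k + 6) (sym (+-assoc j 3 3)) (+-monoˡ-< 6 j<k))

  taken-below : ∀ {k w} → k ≤ n → w < k → Taken k w
  taken-below {k} {w} k≤n w<k with w <? 3
  ... | yes w<3 = inj₁ w<3
  ... | no  w≮3 = inj₂ (j , j<k , πj+3≡w)
    where
      v<n : w ∸ 3 < n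
      v<n = ≤-<-trans (m∸n≤m w 3) (<-≤-trans w<k k≤n)
      j = π⁻¹ (w ∸ 3)
      πj+3≡w : π j + 3 ≡ w
      πj+3≡w = trans (cong (_+ 3) (π-π⁻¹ v<n)) (m∸n+n≡m (≮⇒≥ w≮3))
      j<k : j < k
      j<k with j <? k
      ... | yes j<k = j<k
      ... | no  j≮k = contradiction (≤-trans (≮⇒≥ j≮k) (subst (j ≤_) πj+3≡w (k≤π[k]+3 (π⁻¹-< v<n)))) (<⇒≱ w<k)

  taken-position : ∀ {k j} → k ≤ n → j < n → Taken k (π j + 3) → j < k
  taken-position _   _   (inj₁ πj+3<3) = contradiction πj+3<3 (≤⇒≯ (m≤n+m 3 _))
  taken-position {k} k≤n j<n (inj₂ (j′ , j′<k , e)) =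
    subst (_< k) (π-injective (<-≤-trans j′<k k≤n) j<n (+-cancelʳ-≡ 3 _ _ e)) j′<k

  offset : ℕ → ℕ
  offset k = π k + 3 ∸ k

  k+offset : ∀ {k} → k < n → k + offset k ≡ π k + 3
  k+offset k<n = m+[n∸m]≡n (k≤π[k]+3 k<n)

  offset≤6 : ∀ {k} → k < n → offset k ≤ 6
  offset≤6 {k} k<n = +-cancelˡ-≤ k _ 6 (subst (_≤ k + 6) (sym (k+offset k<n))
    (subst (π k + 3 ≤_) (+-assoc k 3 3) (+-monoˡ-≤ 3 (π[k]≤k+3 k<n))))

  describes-next : ∀ {k s} → k < n → Describes k s → Describes (suc k) (next s (offset k))
  describes-next {k} {s} k<n d {r} r<6 = mk⇔ to from
    where
      shift : k + suc r ≡ suc k + r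
      shift = +-suc k r

      old⇒ : T (bit s (suc r)) → Taken k (suc k + r)
      old⇒ b with suc r <? 6
      ... | yes r+1<6 = subst (Taken k) shift (Equivalence.to (d r+1<6) b)
      ... | no  r+1≮6 = contradiction (subst T (bit-beyond s (≮⇒≥ r+1≮6)) b) λ ()

      ⇒old : Taken k (suc k + r) → T (bit s (suc r))
      ⇒old t with suc r <? 6
      ... | yes r+1<6 = Equivalence.from (d r+1<6) (subst (Taken k) (sym shift) t)
      ... | no  r+1≮6 = contradiction (taken-bounded (<⇒≤ k<n) t)
                          (≤⇒≯ (subst (k + 6 ≤_) shift (+-monoʳ-≤ k (≮⇒≥ r+1≮6))))

      new⇒ : offset k ≡ suc r → π k + 3 ≡ suc k + r
      new⇒ e = trans (sym (k+offset k<n)) (trans (cong (k +_) e) shift)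

      ⇒new : π k + 3 ≡ suc k + r → offset k ≡ suc r
      ⇒new e = +-cancelˡ-≡ k _ _ (trans (k+offset k<n) (trans e (sym shift)))

      to : T (bit (next s (offset k)) r) → Taken (suc k) (suc k + r)
      to b with Equivalence.to T-∨ (subst T (bit-next s (offset k) r<6) b)
      ... | inj₁ b′ = Equivalence.from taken-suc (inj₁ (old⇒ b′))
      ... | inj₂ e  = Equivalence.from taken-suc (inj₂ (new⇒ (≡ᵇ⇒≡ _ _ e)))

      from : Taken (suc k) (suc k + r) → T (bit (next s (offset k)) r)
      from t = subst T (sym (bit-next s (offset k) r<6)) (Equivalence.from T-∨ (cases (Equivalence.to taken-suc t)))
        where
          cases : Taken k (suc k + r) ⊎ π k + 3 ≡ suc k + r → T (bit s (suc r)) ⊎ T (offset k ≡ᵇ suc r)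
          cases (inj₁ t′) = inj₁ (⇒old t′)
          cases (inj₂ e)  = inj₂ (≡⇒≡ᵇ _ _ (⇒new e))

  describes-boundary : Describes 0 boundary
  describes-boundary {0} _ = mk⇔ (λ _ → inj₁ (s≤s z≤n)) _
  describes-boundary {1} _ = mk⇔ (λ _ → inj₁ (s≤s (s≤s z≤n))) _
  describes-boundary {2} _ = mk⇔ (λ _ → inj₁ (s≤s (s≤s (s≤s z≤n)))) _
  describes-boundary {3} _ = mk⇔ (λ ()) λ { (inj₁ (s≤s (s≤s (s≤s ())))) ; (inj₂ (_ , () , _)) }
  describes-boundary {4} _ = mk⇔ (λ ()) λ { (inj₁ (s≤s (s≤s (s≤s ())))) ; (inj₂ (_ , () , _)) }
  describes-boundary {5} _ = mk⇔ (λ ()) λ { (inj₁ (s≤s (s≤s (s≤s ())))) ; (inj₂ (_ , () , _)) }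
  describes-boundary {suc (suc (suc (suc (suc (suc _)))))} (s≤s (s≤s (s≤s (s≤s (s≤s (s≤s ()))))))

  state : ℕ → State
  state zero    = boundary
  state (suc k) = next (state k) (offset k)

  describes-state : ∀ {k} → k ≤ n → Describes k (state k)
  describes-state {zero}  _     = describes-boundary
  describes-state {suc k} 1+k≤n = describes-next {s = state k} 1+k≤n (describes-state (<⇒≤ 1+k≤n))

  module _ {k s} (k<n : k < n) (d : Describes k s) where
    private
      k+o : k + offset k ≡ π k + 3
      k+o = k+offset k<n

      taken-value : ∀ {j} → j < n → Taken k (π j + 3) → j < k
      taken-value = taken-position (<⇒≤ k<n)

    own-slot-free : ¬ T (bit s (offset k))
    own-slot-free b with offset k <? 6
    ... | yes o<6 = <-irrefl refl (taken-value k<n (subst (Taken k) k+o (Equivalence.to (d o<6) b)))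
    ... | no  o≮6 = contradiction (subst T (bit-beyond s (≮⇒≥ o≮6)) b) λ ()

    crossing⇒slot : ∀ {j} → j ∈ crossings k<n → k ≤ π j + 3 × π j + 3 ∸ k ∈ crossingSlots s (offset k)
    crossing⇒slot {j} j∈ with Equivalence.to (∈-crossings k<n) j∈
    ... | j<n , inj₁ (j<k , πk<πj) =
      k≤ , ∈-filter⁺ (crossingSlot? s (offset k)) (∈-upTo⁺ r<6) (inj₁ (o<r , Equivalence.from (d r<6) taken))
      where
        k≤ : k ≤ π j + 3
        k≤ = ≤-trans (k≤π[k]+3 k<n) (+-monoˡ-≤ 3 (<⇒≤ πk<πj))
        k+r : k + (π j + 3 ∸ k) ≡ π j + 3
        k+r = m+[n∸m]≡n k≤
        taken : Taken k (k + (π j + 3 ∸ k))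
        taken = inj₂ (j , j<k , sym k+r)
        r<6 : π j + 3 ∸ k < 6
        r<6 = +-cancelˡ-< k _ 6 (subst (_< k + 6) (sym k+r) (taken-bounded (<⇒≤ k<n) (subst (Taken k) k+r taken)))
        o<r : offset k < π j + 3 ∸ k
        o<r = +-cancelˡ-< k _ _ (subst₂ _<_ (sym k+o) (sym k+r) (+-monoˡ-< 3 πk<πj))
    ... | j<n , inj₂ (k<j , πj<πk) = k≤ , ∈-filter⁺ (crossingSlot? s (offset k)) (∈-upTo⁺ r<6) (inj₂ (r<o , free))
      where
        k≤ : k ≤ π j + 3
        k≤ = ≤-trans (<⇒≤ k<j) (k≤π[k]+3 j<n)
        k+r : k + (π j + 3 ∸ k) ≡ π j + 3
        k+r = m+[n∸m]≡n k≤
        r<o : π j + 3 ∸ k < offset k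
        r<o = +-cancelˡ-< k _ _ (subst₂ _<_ (sym k+r) (sym k+o) (+-monoˡ-< 3 πj<πk))
        r<6 : π j + 3 ∸ k < 6
        r<6 = <-≤-trans r<o (offset≤6 k<n)
        free : ¬ T (bit s (π j + 3 ∸ k))
        free b = <-asym k<j (taken-value j<n (subst (Taken k) k+r (Equivalence.to (d r<6) b)))

    slot⇒crossing : ∀ {r} → r ∈ crossingSlots s (offset k) →
      3 ≤ k + r × k + r ∸ 3 < n × π⁻¹ (k + r ∸ 3) ∈ crossings k<n
    slot⇒crossing {r} r∈ with ∈-filter⁻ (crossingSlot? s (offset k)) r∈
    ... | r∈6 , inj₁ (o<r , b) with Equivalence.to (d (∈-upTo⁻ r∈6)) b
    ...   | inj₁ k+r<3 = contradiction (≤-trans (m≤n+m 3 (π k)) (subst (_≤ k + r) k+o (+-monoʳ-≤ k (<⇒≤ o<r))))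
                           (<⇒≱ k+r<3)
    ...   | inj₂ (j , j<k , e) = 3≤ , v<n , Equivalence.from (∈-crossings k<n)
              (π⁻¹-< v<n , inj₁ (subst (_< k) (sym j≡) j<k , subst (π k <_) (cong π (sym j≡)) πk<πj))
      where
        3≤ : 3 ≤ k + r
        3≤ = subst (3 ≤_) e (m≤n+m 3 (π j))
        v≡ : k + r ∸ 3 ≡ π j
        v≡ = trans (cong (_∸ 3) (sym e)) (m+n∸n≡m (π j) 3)
        v<n : k + r ∸ 3 < n
        v<n = subst (_< n) (sym v≡) (π-< (<-trans j<k k<n))
        j≡ : π⁻¹ (k + r ∸ 3) ≡ j
        j≡ = trans (cong π⁻¹ v≡) (π⁻¹-π (<-trans j<k k<n))
        πk<πj : π k < π j
        πk<πj = +-cancelʳ-< 3 _ _ (subst₂ _<_ k+o (sym e) (+-monoʳ-< k o<r))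
    slot⇒crossing {r} r∈ | r∈6 , inj₂ (r<o , free) = 3≤ , v<n , Equivalence.from (∈-crossings k<n)
      (π⁻¹-< v<n , inj₂ (k<j , subst (_< π k) (sym (π-π⁻¹ v<n)) v<πk))
      where
        r<6 = ∈-upTo⁻ r∈6
        not-taken : ¬ Taken k (k + r)
        not-taken t = free (Equivalence.from (d r<6) t)
        3≤ : 3 ≤ k + r
        3≤ with 3 ≤? k + r
        ... | yes 3≤ = 3≤
        ... | no  3≰ = contradiction (inj₁ (≰⇒> 3≰)) not-taken
        k+r<πk+3 : k + r < π k + 3
        k+r<πk+3 = subst (k + r <_) k+o (+-monoʳ-< k r<o)
        v<πk : k + r ∸ 3 < π k
        v<πk = +-cancelʳ-< 3 _ _ (subst (_< π k + 3) (sym (m∸n+n≡m 3≤)) k+r<πk+3)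
        v<n : k + r ∸ 3 < n
        v<n = <-trans v<πk (π-< k<n)
        j = π⁻¹ (k + r ∸ 3)
        πj+3 : π j + 3 ≡ k + r
        πj+3 = trans (cong (_+ 3) (π-π⁻¹ v<n)) (m∸n+n≡m 3≤)
        k<j : k < j
        k<j with <-cmp k j
        ... | tri< k<j _ _ = k<j
        ... | tri≈ _ k≡j _ = contradiction (trans (sym πj+3) (cong (λ i → π i + 3) (sym k≡j))) (<⇒≢ k+r<πk+3)
        ... | tri> _ _ j<k = contradiction (inj₂ (j , j<k , πj+3)) not-taken

    three-crossing-slots : length (crossingSlots s (offset k)) ≡ 3
    three-crossing-slots = ≤-antisym
      (subst (length (crossingSlots s (offset k)) ≤_) (crossings-length k<n)
        (length-≤-injection (λ r → π⁻¹ (k + r ∸ 3))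
          (Unique.filter⁺ (crossingSlot? s (offset k)) (Unique.upTo⁺ 6))
          (λ r∈ → proj₂ (proj₂ (slot⇒crossing r∈))) slot-injective))
      (subst (_≤ length (crossingSlots s (offset k))) (crossings-length k<n)
        (length-≤-injection (λ j → π j + 3 ∸ k)
          (crossings-unique k<n) (λ j∈ → proj₂ (crossing⇒slot j∈)) crossing-injective))
      where
        slot-injective : ∀ {r r′} → r ∈ crossingSlots s (offset k) → r′ ∈ crossingSlots s (offset k) →
          π⁻¹ (k + r ∸ 3) ≡ π⁻¹ (k + r′ ∸ 3) → r ≡ r′
        slot-injective r∈ r′∈ e with slot⇒crossing r∈ | slot⇒crossing r′∈
        ... | 3≤ , v<n , _ | 3≤′ , v′<n , _ = +-cancelˡ-≡ k _ _
          (trans (sym (m∸n+n≡m 3≤)) (trans (cong (_+ 3) (π⁻¹-injective v<n v′<n e)) (m∸n+n≡m 3≤′)))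

        crossing-injective : ∀ {j j′} → j ∈ crossings k<n → j′ ∈ crossings k<n → π j + 3 ∸ k ≡ π j′ + 3 ∸ k → j ≡ j′
        crossing-injective j∈ j′∈ e = π-injective
          (proj₁ (Equivalence.to (∈-crossings k<n) j∈)) (proj₁ (Equivalence.to (∈-crossings k<n) j′∈))
          (+-cancelʳ-≡ 3 _ _ (trans (sym (m+[n∸m]≡n (proj₁ (crossing⇒slot j∈))))
            (trans (cong (k +_) e) (m+[n∸m]≡n (proj₁ (crossing⇒slot j′∈))))))

    lowest-slot-filled : T (bit s 0) ⊎ offset k ≡ 0
    lowest-slot-filled with T? (bit s 0) | offset k ≟ 0
    ... | yes b | _      = inj₁ b
    ... | no  _ | yes o≡0 = inj₂ o≡0
    ... | no  b | no  o≢0 = contradiction (subst (j ≤_) πj+3≡k (k≤π[k]+3 j<n)) (<⇒≱ k<j)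
      where
        not-taken : ¬ Taken k k
        not-taken t = b (Equivalence.from (d (s≤s z≤n)) (subst (Taken k) (sym (+-identityʳ k)) t))
        3≤k : 3 ≤ k
        3≤k with 3 ≤? k
        ... | yes 3≤k = 3≤k
        ... | no  3≰k = contradiction (inj₁ (≰⇒> 3≰k)) not-taken
        v<n : k ∸ 3 < n
        v<n = ≤-<-trans (m∸n≤m k 3) k<n
        j = π⁻¹ (k ∸ 3)
        j<n = π⁻¹-< v<n
        πj+3≡k : π j + 3 ≡ k
        πj+3≡k = trans (cong (_+ 3) (π-π⁻¹ v<n)) (m∸n+n≡m 3≤k)
        j≮k : ¬ j < k
        j≮k j<k = not-taken (inj₂ (j , j<k , πj+3≡k))
        k<j : k < j
        k<j = ≤∧≢⇒< (≮⇒≥ j≮k) λ k≡j → o≢0 (+-cancelˡ-≡ k _ 0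
          (trans k+o (trans (cong (λ i → π i + 3) k≡j) (trans πj+3≡k (sym (+-identityʳ k))))))

    valid-offset : Valid s (offset k)
    valid-offset = record
      { offset≤6             = offset≤6 k<n
      ; own-slot-free        = own-slot-free
      ; three-crossing-slots = three-crossing-slots
      ; lowest-slot-filled   = lowest-slot-filled
      }

  state-reachable : ∀ {k} → k ≤ n → state k ∈ reachable
  state-reachable {zero}  _     = here refl
  state-reachable {suc k} 1+k≤n = All.lookup reachable-closed (state-reachable (<⇒≤ 1+k≤n))
    (s≤s (offset≤6 1+k≤n)) (valid-offset 1+k≤n (describes-state (<⇒≤ 1+k≤n)))

  state≢boundary : ∀ {k} → 0 < k → k < n → state k ≢ boundary
  state≢boundary {k} 0<k k<n state≡ with indecomposable 0<k k<n
  ... | i , j , i<k , k≤j , j<n , πj<πi = <⇒≱ j<k k≤j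
    where
      d : Describes k boundary
      d = subst (Describes k) state≡ (describes-state (<⇒≤ k<n))

      untaken : ∀ {w} → k + 3 ≤ w → ¬ Taken k w
      untaken {w} k+3≤w t with w <? k + 6
      ... | no  w≮k+6 = w≮k+6 (taken-bounded (<⇒≤ k<n) t)
      ... | yes w<k+6 = boundary-free 3≤r (Equivalence.from (d r<6) (subst (Taken k) (sym k+r) t))
        where
          k≤w = ≤-trans (m≤m+n k 3) k+3≤w
          k+r : k + (w ∸ k) ≡ w
          k+r = m+[n∸m]≡n k≤w
          3≤r : 3 ≤ w ∸ k
          3≤r = +-cancelˡ-≤ k 3 _ (subst (k + 3 ≤_) (sym k+r) k+3≤w)
          r<6 : w ∸ k < 6
          r<6 = +-cancelˡ-< k _ 6 (subst (_< k + 6) (sym k+r) w<k+6)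

      taken : ∀ {w} → w < k + 3 → Taken k w
      taken {w} w<k+3 with w <? k
      ... | yes w<k = taken-below (<⇒≤ k<n) w<k
      ... | no  w≮k = subst (Taken k) k+r (Equivalence.to (d (<-trans r<3 (s≤s (s≤s (s≤s (s≤s z≤n))))))
                        (boundary-taken r<3))
        where
          k+r : k + (w ∸ k) ≡ w
          k+r = m+[n∸m]≡n (≮⇒≥ w≮k)
          r<3 : w ∸ k < 3
          r<3 = +-cancelˡ-< k _ 3 (subst (_< k + 3) (sym k+r) w<k+3)

      πi+3<k+3 : π i + 3 < k + 3
      πi+3<k+3 = ≰⇒> λ k+3≤ → untaken k+3≤ (inj₂ (i , i<k , refl))

      j<k : j < k
      j<k = taken-position (<⇒≤ k<n) j<n (taken (<-trans (+-monoˡ-< 3 πj<πi) πi+3<k+3))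

-- The potential and the window certificate

-- Potential increments for the step from a position with the given state and offset to the next
-- position with the given offset, found by computer search; unlisted steps contribute 0.
δ : State → ℕ → ℕ → ℤ
δ (● ∷ ● ∷ ○ ∷ ○ ∷ ● ∷ ○ ∷ []) 6 2 = -1ℤ
δ (● ∷ ● ∷ ○ ∷ ○ ∷ ○ ∷ ● ∷ []) 4 6 = ℤ.+ 2
δ (● ∷ ● ∷ ○ ∷ ○ ∷ ○ ∷ ● ∷ []) 6 2 = -1ℤ
δ (● ∷ ○ ∷ ● ∷ ● ∷ ○ ∷ ○ ∷ []) 6 0 = -1ℤ
δ (● ∷ ○ ∷ ● ∷ ○ ∷ ○ ∷ ● ∷ []) 4 0 = -1ℤ
δ (● ∷ ○ ∷ ● ∷ ○ ∷ ○ ∷ ● ∷ []) 6 0 = -1ℤ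
δ (● ∷ ○ ∷ ○ ∷ ● ∷ ● ∷ ○ ∷ []) 6 0 = -1ℤ
δ (● ∷ ○ ∷ ○ ∷ ● ∷ ○ ∷ ● ∷ []) 4 0 = -1ℤ
δ (● ∷ ○ ∷ ○ ∷ ● ∷ ○ ∷ ● ∷ []) 6 0 = -1ℤ
δ (● ∷ ○ ∷ ○ ∷ ○ ∷ ● ∷ ● ∷ []) 6 0 = -1ℤ
δ (○ ∷ ● ∷ ● ∷ ○ ∷ ● ∷ ○ ∷ []) 0 6 = ℤ.+ 3
δ (○ ∷ ● ∷ ● ∷ ○ ∷ ○ ∷ ● ∷ []) 0 6 = ℤ.+ 3
δ (○ ∷ ● ∷ ○ ∷ ● ∷ ● ∷ ○ ∷ []) 0 6 = ℤ.+ 3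
δ (○ ∷ ● ∷ ○ ∷ ○ ∷ ● ∷ ● ∷ []) 0 2 = ℤ.+ 2
δ (○ ∷ ● ∷ ○ ∷ ○ ∷ ● ∷ ● ∷ []) 0 6 = ℤ.+ 3
δ _ _ _ = 0ℤ

-- The positions i, …, i + span read from position i: values are shifted values minus i, drift is
-- the potential difference to position i, and history holds (a , value , drift) for each a < span.
record Trace : Set where
  constructor trace
  field
    last-state  : State
    last-offset : ℕ
    span        : ℕ
    first-value : ℕ
    drift       : ℤ
    history     : List (ℕ × ℕ × ℤ)

  value : ℕ
  value = span + last-offset

  successor-state : State
  successor-state = next last-state last-offset

open Trace

start : State → ℕ → Trace
start s o = trace s o 0 o 0ℤ []

extend : Trace → ℕ → Trace
extend x o = trace (successor-state x) o (suc (span x)) (first-value x)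
  (drift x ℤ.+ δ (last-state x) (last-offset x) o) ((span x , value x , drift x) ∷ history x)

_⇔-dec_ : ∀ {A B : Set} → Dec A → Dec B → Dec (A ⇔ B)
a? ⇔-dec b? = map′ (λ (f , g) → mk⇔ f g) (λ e → Equivalence.to e , Equivalence.from e)
  ((a? →-dec b?) ×-dec (b? →-dec a?))

Near : Trace → Set
Near x = 1 ≤ span x → span x ≤ 6 →
  (value x < first-value x → ∣ drift x ∣ ≤ 1) × (∣ drift x ∣ ≡ 1 → value x < first-value x)

near? : ∀ x → Dec (Near x)
near? x = 1 ≤? span x →-dec span x ≤? 6 →-dec
  (value x <? first-value x →-dec ∣ drift x ∣ ≤? 1) ×-dec (∣ drift x ∣ ≟ 1 →-dec value x <? first-value x)

Far : Trace → Set
Far x = 7 ≤ span x → ℤ.+ 2 ℤ.≤ drift x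

far? : ∀ x → Dec (Far x)
far? x = 7 ≤? span x →-dec ℤ.+ 2 ℤ.≤? drift x

Homogeneous : Trace → Set
Homogeneous x = drift x ≡ 0ℤ → All (λ (a , v , D) → D ≡ 0ℤ →
  (value x < v ⇔ value x < first-value x) × (0 < a → (v < first-value x ⇔ value x < first-value x))) (history x)

homogeneous? : ∀ x → Dec (Homogeneous x)
homogeneous? x = drift x ℤ.≟ 0ℤ →-dec all? (λ (a , v , D) → D ℤ.≟ 0ℤ →-dec
  ((value x <? v) ⇔-dec (value x <? first-value x)) ×-dec
  (0 <? a →-dec (v <? first-value x) ⇔-dec (value x <? first-value x))) (history x)

TraceOK : Trace → Set
TraceOK x = Near x × Far x × Homogeneous x

traceOK? : ∀ x → Dec (TraceOK x)
traceOK? x = near? x ×-dec far? x ×-dec homogeneous? x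

OKWithin : ℕ → Trace → Set
OKWithin zero    x = TraceOK x
OKWithin (suc d) x = TraceOK x ×
  (∀ {o} → o < 7 → Valid (successor-state x) o → successor-state x ≢ boundary → OKWithin d (extend x o))

okWithin? : ∀ d x → Dec (OKWithin d x)
okWithin? zero    x = traceOK? x
okWithin? (suc d) x = traceOK? x ×-dec allUpTo? (λ o → valid? (successor-state x) o →-dec
  ¬? (≡-dec Bool._≟_ (successor-state x) boundary) →-dec okWithin? d (extend x o)) 7

StartsWell : State → Set
StartsWell s = ∀ {o} → o < 7 → Valid s o → OKWithin 13 (start s o)

reachable-starts-well : All StartsWell reachable
reachable-starts-well =
  toWitness {a? = all? (λ s → allUpTo? (λ o → valid? s o →-dec okWithin? 13 (start s o)) 7) reachable} tt

module Layers {n} (C : CubicPermutation n) where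
  open CubicPermutation C
  open Displacement C
  open Prefix C

  potential : ℕ → ℤ
  potential zero    = 0ℤ
  potential (suc k) = potential k ℤ.+ δ (state k) (offset k) (offset (suc k))

  window : ℕ → ℕ → Trace
  window i zero    = start (state i) (offset i)
  window i (suc u) = extend (window i u) (offset (i + suc u))

  span-window : ∀ i u → span (window i u) ≡ u
  span-window i zero    = refl
  span-window i (suc u) = cong suc (span-window i u)

  last-offset-window : ∀ i u → last-offset (window i u) ≡ offset (i + u)
  last-offset-window i zero    = cong offset (sym (+-identityʳ i))
  last-offset-window i (suc u) = refl

  last-state-window : ∀ i u → last-state (window i u) ≡ state (i + u)
  last-state-window i zero    = cong state (sym (+-identityʳ i))
  last-state-window i (suc u) = begin
    next (last-state (window i u)) (last-offset (window i u))
      ≡⟨ cong₂ next (last-state-window i u) (last-offset-window i u) ⟩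
    state (suc (i + u))  ≡⟨ cong state (+-suc i u) ⟨
    state (i + suc u)    ∎
    where open ≡-Reasoning

  drift-window : ∀ i u → drift (window i u) ≡ potential (i + u) ℤ.- potential i
  drift-window i zero rewrite +-identityʳ i = sym (ℤ.+-inverseʳ (potential i))
  drift-window i (suc u)
    rewrite drift-window i u | last-state-window i u | last-offset-window i u | +-suc i u =
      shuffle (potential (i + u)) (potential i) _
    where
      shuffle : ∀ a b d → (a ℤ.- b) ℤ.+ d ≡ (a ℤ.+ d) ℤ.- b
      shuffle = solve-∀

  value-window : ∀ {i u} → i + u < n → i + value (window i u) ≡ π (i + u) + 3
  value-window {i} {u} i+u<n = begin
    i + (span (window i u) + last-offset (window i u))
      ≡⟨ cong₂ (λ a o → i + (a + o)) (span-window i u) (last-offset-window i u) ⟩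
    i + (u + offset (i + u))  ≡⟨ +-assoc i u _ ⟨
    i + u + offset (i + u)    ≡⟨ k+offset i+u<n ⟩
    π (i + u) + 3             ∎
    where open ≡-Reasoning

  first-value-window : ∀ i u → first-value (window i u) ≡ offset i
  first-value-window i zero    = refl
  first-value-window i (suc u) = first-value-window i u

  history-window : ∀ {i a u} → a < u →
    (span (window i a) , value (window i a) , drift (window i a)) ∈ history (window i u)
  history-window {u = suc u} a<1+u with m≤n⇒m<n∨m≡n (≤-pred a<1+u)
  ... | inj₁ a<u  = there (history-window a<u)
  ... | inj₂ refl = here refl

  window-ok-within : ∀ {i u} → i + u < n → u ≤ 13 → OKWithin (13 ∸ u) (window i u)
  window-ok-within {i} {zero} i+0<n _ =
    All.lookup reachable-starts-well (state-reachable (<⇒≤ i<n))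
      (s≤s (offset≤6 i<n)) (valid-offset i<n (describes-state (<⇒≤ i<n)))
    where i<n = subst (_< n) (+-identityʳ i) i+0<n
  window-ok-within {i} {suc u} i+1+u<n 1+u≤13 =
    proj₂ (subst (λ d → OKWithin d (window i u)) (+-∸-assoc 1 (≤-pred 1+u≤13)) earlier)
      (s≤s (offset≤6 i+1+u<n))
      (subst (λ s → Valid s (offset (i + suc u))) (sym successor≡)
        (valid-offset i+1+u<n (describes-state (<⇒≤ i+1+u<n))))
      (λ e → state≢boundary (<-≤-trans (s≤s z≤n) (m≤n+m (suc u) i)) i+1+u<n (trans (sym successor≡) e))
    where
      earlier = window-ok-within (≤-<-trans (+-monoʳ-≤ i (n≤1+n u)) i+1+u<n) (≤-trans (n≤1+n u) 1+u≤13)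
      successor≡ : successor-state (window i u) ≡ state (i + suc u)
      successor≡ = last-state-window i (suc u)

  window-ok : ∀ {i u} → i + u < n → u ≤ 13 → TraceOK (window i u)
  window-ok {u = u} i+u<n u≤13 = ok-within⇒ok (13 ∸ u) (window-ok-within i+u<n u≤13)
    where
      ok-within⇒ok : ∀ d {x} → OKWithin d x → TraceOK x
      ok-within⇒ok zero    ok       = ok
      ok-within⇒ok (suc d) (ok , _) = ok

  <-shift : ∀ {i a b p q} → i + a ≡ p + 3 → i + b ≡ q + 3 → a < b ⇔ p < q
  <-shift {i} ea eb = mk⇔
    (λ a<b → +-cancelʳ-< 3 _ _ (subst₂ _<_ ea eb (+-monoʳ-< i a<b)))
    (λ p<q → +-cancelˡ-< i _ _ (subst₂ _<_ (sym ea) (sym eb) (+-monoˡ-< 3 p<q)))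

  first-value-shift : ∀ {i} u → i < n → i + first-value (window i u) ≡ π i + 3
  first-value-shift {i} u i<n = trans (cong (λ o → i + o) (first-value-window i u)) (k+offset i<n)

  inverted⇔value<first : ∀ {i u} → i + u < n → π (i + u) < π i ⇔ value (window i u) < first-value (window i u)
  inverted⇔value<first {i} {u} i+u<n =
    ⇔.sym (<-shift (value-window {i} {u} i+u<n) (first-value-shift u (≤-<-trans (m≤m+n i u) i+u<n)))

  far-drift : ∀ u → 7 ≤ u → ∀ {i} → i + u < n → ℤ.+ 2 ℤ.≤ potential (i + u) ℤ.- potential i
  far-drift = <-rec _ step
    where
      step : ∀ u → (∀ {v} → v < u → 7 ≤ v → ∀ {i} → i + v < n → ℤ.+ 2 ℤ.≤ potential (i + v) ℤ.- potential i) →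
        7 ≤ u → ∀ {i} → i + u < n → ℤ.+ 2 ℤ.≤ potential (i + u) ℤ.- potential i
      step u rec 7≤u {i} i+u<n with u ≤? 13
      ... | yes u≤13 = subst (ℤ.+ 2 ℤ.≤_) (drift-window i u)
              (proj₁ (proj₂ (window-ok i+u<n u≤13)) (subst (7 ≤_) (sym (span-window i u)) 7≤u))
      ... | no  u≰13 = subst (ℤ.+ 2 ℤ.≤_) telescope (ℤ.≤-trans (ℤ.+≤+ (m≤m+n 2 2)) (ℤ.+-mono-≤
              (rec (∸-monoʳ-< (s≤s z≤n) 7≤u) 7≤u-7 i+7+[u-7]<n)
              (rec (≤-trans (m≤m+n 8 6) 14≤u) ≤-refl
                (≤-<-trans (m≤m+n (i + 7) (u ∸ 7)) i+7+[u-7]<n))))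
        where
          14≤u : 14 ≤ u
          14≤u = ≰⇒> u≰13
          7+[u-7] : 7 + (u ∸ 7) ≡ u
          7+[u-7] = m+[n∸m]≡n 7≤u
          7≤u-7 : 7 ≤ u ∸ 7
          7≤u-7 = +-cancelˡ-≤ 7 7 _ (subst (14 ≤_) (sym 7+[u-7]) 14≤u)
          i+7+[u-7] : i + 7 + (u ∸ 7) ≡ i + u
          i+7+[u-7] = trans (+-assoc i 7 _) (cong (λ v → i + v) 7+[u-7])
          i+7+[u-7]<n : i + 7 + (u ∸ 7) < n
          i+7+[u-7]<n = subst (_< n) (sym i+7+[u-7]) i+u<n
          telescope : (potential (i + 7 + (u ∸ 7)) ℤ.- potential (i + 7)) ℤ.+ (potential (i + 7) ℤ.- potential i)
            ≡ potential (i + u) ℤ.- potential i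
          telescope = trans (ℤ.+-minus-telescope (potential (i + 7 + (u ∸ 7))) (potential (i + 7)) (potential i))
            (cong (λ k → potential k ℤ.- potential i) i+7+[u-7])

  near-window : ∀ {i u} → i + u < n → 1 ≤ u → u ≤ 6 →
    (π (i + u) < π i → ∣ potential (i + u) ℤ.- potential i ∣ ≤ 1) ×
    (∣ potential (i + u) ℤ.- potential i ∣ ≡ 1 → π (i + u) < π i)
  near-window {i} {u} i+u<n 1≤u u≤6 =
    (λ inv → subst (λ D → ∣ D ∣ ≤ 1) (drift-window i u) (proj₁ near (Equivalence.to inverted inv))) ,
    (λ ∣Δ∣≡1 → Equivalence.from inverted (proj₂ near (subst (λ D → ∣ D ∣ ≡ 1) (sym (drift-window i u)) ∣Δ∣≡1)))
    where
      inverted = inverted⇔value<first i+u<n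
      near = proj₁ (window-ok i+u<n (≤-trans u≤6 (m≤m+n 6 7)))
               (subst (1 ≤_) (sym (span-window i u)) 1≤u) (subst (_≤ 6) (sym (span-window i u)) u≤6)

  distant-uninverted : ∀ {i j} → i + 7 ≤ j → j < n → ¬ π j < π i
  distant-uninverted {i} {j} i+7≤j j<n πj<πi = <⇒≱ (+-monoˡ-< 3 πj<πi) (begin
    π i + 3       ≤⟨ +-monoˡ-≤ 3 (π[k]≤k+3 i<n) ⟩
    i + 3 + 3     ≡⟨ +-assoc i 3 3 ⟩
    i + 6         ≤⟨ n≤1+n (i + 6) ⟩
    suc (i + 6)   ≡⟨ +-suc i 6 ⟨
    i + 7         ≤⟨ i+7≤j ⟩
    j             ≤⟨ k≤π[k]+3 j<n ⟩
    π j + 3       ∎)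
    where
      open ≤-Reasoning
      i<n = <-trans (≤-<-trans (m≤m+n i 6) (subst (_≤ j) (+-suc i 6) i+7≤j)) j<n

  private
    at-distance : ∀ {i j} → i < j → ∃ λ u → 1 ≤ u × i + u ≡ j
    at-distance {i} i<j with m≤n⇒∃[o]m+o≡n i<j
    ... | k , e = suc k , s≤s z≤n , trans (+-suc i k) e

  inverted⇒∣Δpotential∣≤1 : ∀ {i j} → i < j → j < n → π j < π i → ∣ potential j ℤ.- potential i ∣ ≤ 1
  inverted⇒∣Δpotential∣≤1 {i} i<j j<n πj<πi with at-distance i<j
  ... | u , 1≤u , refl with u ≤? 6
  ...   | yes u≤6 = proj₁ (near-window j<n 1≤u u≤6) πj<πi
  ...   | no  u≰6 = contradiction πj<πi (distant-uninverted (+-monoʳ-≤ i (≰⇒> u≰6)) j<n)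

  ∣Δpotential∣≡1⇒inverted : ∀ {i j} → i < j → j < n → ∣ potential j ℤ.- potential i ∣ ≡ 1 → π j < π i
  ∣Δpotential∣≡1⇒inverted {i} i<j j<n ∣Δ∣≡1 with at-distance i<j
  ... | u , 1≤u , refl with u ≤? 6
  ...   | yes u≤6 = proj₂ (near-window j<n 1≤u u≤6) ∣Δ∣≡1
  ...   | no  u≰6 = contradiction ∣Δ∣≡1 (2≤i⇒∣i∣≢1 (far-drift u (≰⇒> u≰6) j<n))
    where
      2≤i⇒∣i∣≢1 : ∀ {D} → ℤ.+ 2 ℤ.≤ D → ∣ D ∣ ≢ 1
      2≤i⇒∣i∣≢1 (ℤ.+≤+ (s≤s (s≤s _))) ()

  same-potential⇒near : ∀ {i j} → i ≤ j → j < n → potential j ≡ potential i → j ≤ i + 6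
  same-potential⇒near {i} i≤j j<n same with m≤n⇒∃[o]m+o≡n i≤j
  ... | u , refl with u ≤? 6
  ...   | yes u≤6 = +-monoʳ-≤ i u≤6
  ...   | no  u≰6 with subst (ℤ.+ 2 ℤ.≤_) (ℤ.i≡j⇒i-j≡0 same) (far-drift u (≰⇒> u≰6) j<n)
  ...     | ℤ.+≤+ ()

  orientation-against-base : ∀ {m x y} → m ≤ x → x < y → y < n → y ≤ m + 6 →
    potential x ≡ potential m → potential y ≡ potential m →
    (π y < π x ⇔ π y < π m) × (m < x → (π x < π m ⇔ π y < π m))
  orientation-against-base {m} m≤x x<y y<n y≤m+6 same-x same-y
    with m≤n⇒∃[o]m+o≡n m≤x | m≤n⇒∃[o]m+o≡n (≤-trans m≤x (<⇒≤ x<y))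
  ... | a , refl | u , refl =
    ⇔.trans (⇔.trans (⇔.sym (<-shift {m} (value-window {m} {u} y<n) (value-window {m} {a} x<n))) (proj₁ entry))
            (⇔.sym inverted-y⇔) ,
    λ m<x → ⇔.trans (⇔.trans (⇔.sym (<-shift {m} (value-window {m} {a} x<n) first)) (proj₂ entry (0<a m<x)))
                    (⇔.sym inverted-y⇔)
    where
      x<n = <-trans x<y y<n
      first = first-value-shift u (≤-<-trans (m≤m+n m u) y<n)
      inverted-y⇔ : π (m + u) < π m ⇔ value (window m u) < first-value (window m u)
      inverted-y⇔ = inverted⇔value<first y<n
      entry = All.lookup (proj₂ (proj₂ (window-ok y<n (≤-trans (+-cancelˡ-≤ m u 6 y≤m+6) (m≤m+n 6 7))))
                (trans (drift-window m u) (ℤ.i≡j⇒i-j≡0 same-y)))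
                (history-window {m} (+-cancelˡ-< m a u x<y))
                (trans (drift-window m a) (ℤ.i≡j⇒i-j≡0 same-x))
      0<a : m < m + a → 0 < span (window m a)
      0<a m<x = subst (0 <_) (sym (span-window m a)) (+-cancelˡ-< m 0 a (subst (_< m + a) (sym (+-identityʳ m)) m<x))

  -- Within the window starting at m = a ⊓ c, every pair of the level is oriented like the pair
  -- formed by m and its right end, and all such pairs with m are oriented alike.
  level-homogeneous : ∀ {a b c d ℓ} → a < b → b < n → c < d → d < n →
    potential a ≡ ℓ → potential b ≡ ℓ → potential c ≡ ℓ → potential d ≡ ℓ →
    π d < π c → π b < π a
  level-homogeneous {a} {b} {c} {d} {ℓ} a<b b<n c<d d<n at-a at-b at-c at-d πd<πc =
    Equivalence.from (outer m≤a a<b b<n at-a at-b)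
      (Equivalence.from m-to-b⇔m-to-d (Equivalence.to (outer m≤c c<d d<n at-c at-d) πd<πc))
    where
      m = a ⊓ c
      m≤a = m⊓n≤m a c
      m≤c = m⊓n≤n a c

      at-m : potential m ≡ ℓ
      at-m with ⊓-sel a c
      ... | inj₁ m≡a = trans (cong potential m≡a) at-a
      ... | inj₂ m≡c = trans (cong potential m≡c) at-c

      pair : ∀ {x y} → m ≤ x → x < y → y < n → potential x ≡ ℓ → potential y ≡ ℓ →
        (π y < π x ⇔ π y < π m) × (m < x → (π x < π m ⇔ π y < π m))
      pair m≤x x<y y<n ex ey = orientation-against-base m≤x x<y y<n
        (same-potential⇒near (≤-trans m≤x (<⇒≤ x<y)) y<n ey′) (trans ex (sym at-m)) ey′
        where ey′ = trans ey (sym at-m)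

      outer : ∀ {x y} → m ≤ x → x < y → y < n → potential x ≡ ℓ → potential y ≡ ℓ → π y < π x ⇔ π y < π m
      outer m≤x x<y y<n ex ey = proj₁ (pair m≤x x<y y<n ex ey)

      m-to-b⇔m-to-d : π b < π m ⇔ π d < π m
      m-to-b⇔m-to-d with <-cmp b d
      ... | tri< b<d _ _ = proj₂ (pair (≤-trans m≤a (<⇒≤ a<b)) b<d d<n at-b at-d) (≤-<-trans m≤a a<b)
      ... | tri≈ _ refl _ = ⇔.refl
      ... | tri> _ _ d<b = ⇔.sym (proj₂ (pair (≤-trans m≤c (<⇒≤ c<d)) d<b b<n at-d at-b) (≤-<-trans m≤c c<d))

-- Permutation graphs

sum-indicator≡length-filter : ∀ {A : Set} (p : A → Bool) xs →
  sum (map (λ x → if p x then 1 else 0) xs) ≡ length (filterᵇ p xs)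
sum-indicator≡length-filter p []       = refl
sum-indicator≡length-filter p (x ∷ xs) with p x
... | true  = cong suc (sum-indicator≡length-filter p xs)
... | false = sum-indicator≡length-filter p xs

walk-crosses : ∀ {ℓ} {V : Set} {E : Rel V ℓ} (h : V → ℕ) k {x y} → Star E x y → h x < k → k ≤ h y →
  ∃₂ λ a b → E a b × h a < k × k ≤ h b
walk-crosses h k ε           hx<k k≤hy = contradiction (<-≤-trans hx<k k≤hy) (<-irrefl refl)
walk-crosses h k (_◅_ {j = z} e w) hx<k k≤hy with h z <? k
... | yes hz<k = walk-crosses h k w hz<k k≤hy
... | no  hz≮k = _ , z , e , hx<k , ≮⇒≥ hz≮k

onℕ : ∀ {n} → (Fin n → Fin n) → ℕ → ℕ
onℕ {n} f j with j <? n
... | yes j<n = toℕ (f (fromℕ< j<n))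
... | no  _   = 0

onℕ-fromℕ< : ∀ {n} (f : Fin n → Fin n) {j} (j<n : j < n) → onℕ f j ≡ toℕ (f (fromℕ< j<n))
onℕ-fromℕ< {n} f {j} j<n with j <? n
... | yes _   = refl
... | no  j≮n = contradiction j<n j≮n

onℕ-toℕ : ∀ {n} (f : Fin n → Fin n) i → onℕ f (toℕ i) ≡ toℕ (f i)
onℕ-toℕ f i = trans (onℕ-fromℕ< f (toℕ<n i)) (cong (toℕ ∘ f) (fromℕ<-toℕ i (toℕ<n i)))

module PermutationGraph {n} (G : Graph n) (connected : Connected G) (cubic : Regular 3 G)
  (σ π : Permutation′ n)
  (realises : ∀ (i j : Fin n) → i Fin.< j → (Edge G (σ ⟨$⟩ʳ i) (σ ⟨$⟩ʳ j) ⇔ (π ⟨$⟩ʳ j) Fin.< (π ⟨$⟩ʳ i))) where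

  πℕ π⁻¹ℕ : ℕ → ℕ
  πℕ   = onℕ (π ⟨$⟩ʳ_)
  π⁻¹ℕ = onℕ (π ⟨$⟩ˡ_)

  position : Fin n → ℕ
  position v = toℕ (σ ⟨$⟩ˡ v)

  vertex : ∀ {j} → j < n → Fin n
  vertex j<n = σ ⟨$⟩ʳ fromℕ< j<n

  position-vertex : ∀ {j} (j<n : j < n) → position (vertex j<n) ≡ j
  position-vertex j<n = trans (cong toℕ (inverseˡ σ)) (toℕ-fromℕ< j<n)

  position-injective : ∀ {u v} → position u ≡ position v → u ≡ v
  position-injective {u} {v} e =
    trans (sym (inverseʳ σ)) (trans (cong (σ ⟨$⟩ʳ_) (toℕ-injective e)) (inverseʳ σ))

  πℕ-position : ∀ v → πℕ (position v) ≡ toℕ (π ⟨$⟩ʳ (σ ⟨$⟩ˡ v))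
  πℕ-position v = onℕ-toℕ (π ⟨$⟩ʳ_) (σ ⟨$⟩ˡ v)

  no-loop : ∀ {u} → ¬ Edge G u u
  no-loop {u} e with () ← trans (sym e) (irrefl G u)

  edge-sym : ∀ {u v} → Edge G u v → Edge G v u
  edge-sym {u} {v} e = trans (Graph.sym G v u) e

  edge⇔inverted : ∀ {u v} → position u < position v → Edge G u v ⇔ πℕ (position v) < πℕ (position u)
  edge⇔inverted {u} {v} u<v =
    subst₂ (λ p q → Edge G u v ⇔ p < q) (sym (πℕ-position v)) (sym (πℕ-position u))
      (subst₂ (λ a b → Edge G a b ⇔ _) (inverseʳ σ) (inverseʳ σ) (realises _ _ u<v))

  edge⇔crosses : ∀ {u v} → Edge G u v ⇔ Crosses πℕ (position u) (position v)
  edge⇔crosses {u} {v} with <-cmp (position u) (position v)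
  ... | tri< u<v _ v≮u = mk⇔ (λ e → inj₂ (u<v , Equivalence.to (edge⇔inverted u<v) e))
    λ { (inj₁ (v<u , _)) → contradiction v<u v≮u
      ; (inj₂ (_ , πv<πu)) → Equivalence.from (edge⇔inverted u<v) πv<πu }
  ... | tri≈ _ u≡v _ = mk⇔ (λ e → contradiction (subst (Edge G u) (sym (position-injective u≡v)) e) no-loop)
    λ { (inj₁ (v<u , _)) → contradiction (subst (_< position u) (sym u≡v) v<u) (<-irrefl refl)
      ; (inj₂ (u<v , _)) → contradiction (subst (position u <_) (sym u≡v) u<v) (<-irrefl refl) }
  ... | tri> u≮v _ v<u = mk⇔ (λ e → inj₁ (v<u , Equivalence.to (edge⇔inverted v<u) (edge-sym e)))
    λ { (inj₁ (_ , πu<πv)) → edge-sym (Equivalence.from (edge⇔inverted v<u) πu<πv)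
      ; (inj₂ (u<v , _)) → contradiction u<v u≮v }

  πℕ-< : ∀ {j} → j < n → πℕ j < n
  πℕ-< j<n = subst (_< n) (sym (onℕ-fromℕ< _ j<n)) (toℕ<n _)

  π⁻¹ℕ-< : ∀ {v} → v < n → π⁻¹ℕ v < n
  π⁻¹ℕ-< v<n = subst (_< n) (sym (onℕ-fromℕ< _ v<n)) (toℕ<n _)

  πℕ-π⁻¹ℕ : ∀ {v} → v < n → πℕ (π⁻¹ℕ v) ≡ v
  πℕ-π⁻¹ℕ {v} v<n = begin
    πℕ (π⁻¹ℕ v)                               ≡⟨ cong πℕ (onℕ-fromℕ< _ v<n) ⟩
    πℕ (toℕ (π ⟨$⟩ˡ fromℕ< v<n))               ≡⟨ onℕ-toℕ _ _ ⟩
    toℕ (π ⟨$⟩ʳ (π ⟨$⟩ˡ fromℕ< v<n))           ≡⟨ cong toℕ (inverseʳ π) ⟩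
    toℕ (fromℕ< v<n)                          ≡⟨ toℕ-fromℕ< v<n ⟩
    v                                         ∎
    where open ≡-Reasoning

  π⁻¹ℕ-πℕ : ∀ {j} → j < n → π⁻¹ℕ (πℕ j) ≡ j
  π⁻¹ℕ-πℕ {j} j<n = begin
    π⁻¹ℕ (πℕ j)                               ≡⟨ cong π⁻¹ℕ (onℕ-fromℕ< _ j<n) ⟩
    π⁻¹ℕ (toℕ (π ⟨$⟩ʳ fromℕ< j<n))             ≡⟨ onℕ-toℕ _ _ ⟩
    toℕ (π ⟨$⟩ˡ (π ⟨$⟩ʳ fromℕ< j<n))           ≡⟨ cong toℕ (inverseˡ π) ⟩
    toℕ (fromℕ< j<n)                          ≡⟨ toℕ-fromℕ< j<n ⟩
    j                                         ∎
    where open ≡-Reasoning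

  neighbours : ∀ {k} → k < n → List (Fin n)
  neighbours k<n = filterᵇ (adj G (vertex k<n)) (allFin n)

  crossings : ∀ {k} → k < n → List ℕ
  crossings k<n = map position (neighbours k<n)

  crossings-length : ∀ {k} (k<n : k < n) → length (crossings k<n) ≡ 3
  crossings-length k<n = begin
    length (map position (neighbours k<n))    ≡⟨ length-map position (neighbours k<n) ⟩
    length (neighbours k<n)                   ≡⟨ sum-indicator≡length-filter (adj G (vertex k<n)) (allFin n) ⟨
    degree G (vertex k<n)                     ≡⟨ cubic (vertex k<n) ⟩
    3                                         ∎
    where open ≡-Reasoning

  ∈-crossings : ∀ {k j} (k<n : k < n) → j ∈ crossings k<n ⇔ (j < n × Crosses πℕ k j)
  ∈-crossings {k} {j} k<n = mk⇔ to from
    where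
      v = vertex k<n
      to : j ∈ crossings k<n → j < n × Crosses πℕ k j
      to j∈ with ∈-map⁻ position j∈
      ... | w , w∈ , refl = toℕ<n _ , subst (λ i → Crosses πℕ i (position w)) (position-vertex k<n)
        (Equivalence.to edge⇔crosses (Equivalence.to T-≡ (proj₂ (∈-filter⁻ (T? ∘ adj G v) {xs = allFin n} w∈))))
      from : j < n × Crosses πℕ k j → j ∈ crossings k<n
      from (j<n , c) = subst (_∈ crossings k<n) (position-vertex j<n) (∈-map⁺ position
        (∈-filter⁺ (T? ∘ adj G v) (∈-allFin (vertex j<n)) (Equivalence.from T-≡ (Equivalence.from edge⇔crosses
          (subst₂ (Crosses πℕ) (sym (position-vertex k<n)) (sym (position-vertex j<n)) c)))))

  indecomposable : ∀ {k} → 0 < k → k < n → ∃₂ λ i j → i < k × k ≤ j × j < n × πℕ j < πℕ i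
  indecomposable {k} 0<k k<n
    with walk-crosses position k (proj₂ connected (vertex (proj₁ connected)) (vertex k<n))
           (subst (_< k) (sym (position-vertex (proj₁ connected))) 0<k)
           (subst (k ≤_) (sym (position-vertex k<n)) ≤-refl)
  ... | a , b , e , a<k , k≤b with Equivalence.to edge⇔crosses e
  ...   | inj₁ (b<a , _)     = contradiction (<-trans b<a a<k) (λ b<k → <-irrefl refl (<-≤-trans b<k k≤b))
  ...   | inj₂ (_ , πb<πa) = position a , position b , a<k , k≤b , toℕ<n _ , πb<πa

  cubicPermutation : CubicPermutation n
  cubicPermutation = record
    { π                = πℕ
    ; π⁻¹              = π⁻¹ℕ
    ; π-<              = πℕ-<
    ; π⁻¹-<            = π⁻¹ℕ-<
    ; π-π⁻¹            = πℕ-π⁻¹ℕ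
    ; π⁻¹-π            = π⁻¹ℕ-πℕ
    ; crossings        = crossings
    ; crossings-unique = λ k<n → Unique.map⁺ position-injective (Unique.filter⁺ _ (Unique.allFin⁺ n))
    ; crossings-length = crossings-length
    ; ∈-crossings      = ∈-crossings
    ; indecomposable   = indecomposable
    }

  open Layers cubicPermutation using (potential; inverted⇒∣Δpotential∣≤1; ∣Δpotential∣≡1⇒inverted; level-homogeneous)

  layer : Fin n → ℤ
  layer v = potential (position v)

  edge⇒∣Δlayer∣≤1 : ∀ {u v} → Edge G u v → ∣ layer u ℤ.- layer v ∣ ≤ 1
  edge⇒∣Δlayer∣≤1 {u} {v} e with Equivalence.to edge⇔crosses e
  ... | inj₁ (v<u , πu<πv) = inverted⇒∣Δpotential∣≤1 v<u (toℕ<n _) πu<πv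
  ... | inj₂ (u<v , πv<πu) =
    subst (_≤ 1) (ℤ.∣i-j∣≡∣j-i∣ (layer v) (layer u)) (inverted⇒∣Δpotential∣≤1 u<v (toℕ<n _) πv<πu)

  ∣Δlayer∣≡1⇒edge : ∀ {u v} → ∣ layer u ℤ.- layer v ∣ ≡ 1 → Edge G u v
  ∣Δlayer∣≡1⇒edge {u} {v} ∣Δ∣≡1 with <-cmp (position u) (position v)
  ... | tri< u<v _ _ = Equivalence.from edge⇔crosses (inj₂ (u<v ,
        ∣Δpotential∣≡1⇒inverted u<v (toℕ<n _) (trans (ℤ.∣i-j∣≡∣j-i∣ (layer v) (layer u)) ∣Δ∣≡1)))
  ... | tri> _ _ v<u = Equivalence.from edge⇔crosses (inj₁ (v<u , ∣Δpotential∣≡1⇒inverted v<u (toℕ<n _) ∣Δ∣≡1))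
  ... | tri≈ _ u≡v _ with position-injective u≡v
  ...   | refl = contradiction (trans (cong ∣_∣ (sym (ℤ.+-inverseʳ (layer u)))) ∣Δ∣≡1) λ ()

  inverted-within-level : ∀ {x y a b ℓ} → Edge G x y → layer x ≡ ℓ → layer y ≡ ℓ →
    potential a ≡ ℓ → potential b ≡ ℓ → a < b → b < n → πℕ b < πℕ a
  inverted-within-level e at-x at-y at-a at-b a<b b<n with Equivalence.to edge⇔crosses e
  ... | inj₁ (y<x , πx<πy) = level-homogeneous a<b b<n y<x (toℕ<n _) at-a at-b at-y at-x πx<πy
  ... | inj₂ (x<y , πy<πx) = level-homogeneous a<b b<n x<y (toℕ<n _) at-a at-b at-x at-y πy<πx

  layer-homogeneous : ∀ {u v x y} → u ≢ v → layer u ≡ layer v →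
    layer x ≡ layer u → layer y ≡ layer u → Edge G x y → Edge G u v
  layer-homogeneous {u} {v} u≢v same-v same-x same-y e with <-cmp (position u) (position v)
  ... | tri< u<v _ _ = Equivalence.from edge⇔crosses
        (inj₂ (u<v , inverted-within-level e same-x same-y refl (sym same-v) u<v (toℕ<n _)))
  ... | tri≈ _ u≡v _ = contradiction (position-injective u≡v) u≢v
  ... | tri> _ _ v<u = Equivalence.from edge⇔crosses
        (inj₁ (v<u , inverted-within-level e same-x same-y (sym same-v) refl v<u (toℕ<n _)))

  layering : Layering G
  layering = record
    { layer             = layer
    ; edge⇒∣Δlayer∣≤1   = edge⇒∣Δlayer∣≤1
    ; ∣Δlayer∣≡1⇒edge   = ∣Δlayer∣≡1⇒edge
    ; layer-homogeneous = layer-homogeneous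
    }

theorem4p5 : ∀ (n : ℕ) (G : Graph n) → Connected G → Regular 3 G →
    IsPermutationGraph G → IsBlowupOfPath G
theorem4p5 n G connected cubic (σ , π , realises) =
  layering⇒blowupOfPath connected (PermutationGraph.layering G connected cubic σ π realises)
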